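{- Let $G$ be a finite sober connected graph with $\mathrm{c\text{ - }rk}\,G=3$ and minimum vertex degree at least 2. Then the Levi graph of $\mathrm{Geo}\,G$ is isomorphic to the restricted Hasse graph of $\mathrm{Fl}\,G$.
   Context: Graphs are finite, undirected, without loops or multiple edges. $\mathrm{St}(v)$ is the set of neighbours of $v$, $\mathrm{St}(W)=\bigcap_{w\in W}\mathrm{St}(w)$ with $\mathrm{St}(\emptyset)=V$, $\mathrm{Fl}\,G=\{\mathrm{St}(W)\mid W\subseteq V\}$ ordered by inclusion. $G$ is sober if $v\mapsto\mathrm{St}(v)$ is injective. $\mathrm{c\text{ - }rk}\,G$ is the maximum number of independent columns of the $V\times V$ boolean matrix $A^c$ (entry $0$ if $\{i,j\}\in E$, else $1$), where vectors over the superboolean semiring $\{0,1,1^\nu\}$ (with $0+x=x$, $1+1=1^\nu$, $1^\nu+x=1^\nu$, $0\cdot x=0$, $1\cdot1=1$, $1\cdot1^\nu=1^\nu\cdot1^\nu=1^\nu$) are dependent if some $\{0,1\}$-combination with not all coefficients zero has all coordinates in $\{0,1^\nu\}$. $\mathrm{Geo}\,G=(V,\mathcal L_G)$ with $\mathcal L_G=\{W\in\mathrm{Fl}\,G\setminus\{V\}\mid|W|\ge2\}$. For a pair $(P,\mathcal L)$ with $\mathcal L\subseteq2^P$, its Levi graph has vertex set $P\cup\mathcal L$ and edges $\{p,L\}$ for $p\in L\in\mathcal L$. The restricted Hasse graph of $\mathrm{Fl}\,G$ has vertex set $\mathrm{Fl}\,G\setminus\{V,\emptyset\}$, with $x,y$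 adjacent iff one covers the other in $\mathrm{Fl}\,G$. -}

module Defs where

open import Data.Nat using (ℕ; zero; suc; _≤_)
open import Data.Bool using (Bool; true; false; _∧_; _∨_; not; if_then_else_)
open import Data.Fin using (Fin)
import Data.Fin as F
open import Data.Vec using (tabulate)
open import Data.Fin.Subset using (Subset; _∈_; _⊆_; _⊂_; ⊤; ⊥; ∣_∣; Nonempty)
open import Data.Sum using (_⊎_; inj₁; inj₂)
open import Data.Product using (_×_; ∃)
open import Data.Empty renaming (⊥ to Empty)
open import Relation.Nullary using (¬_)
open import Relation.Binary.PropositionalEquality using (_≡_; _≢_)
open import Function.Bundles using (_⤖_; _⇔_; Bijection)
open import Data.Refinement using (Refinement; value)

record Graph (n : ℕ) : Set where
  field
    adj   : Fin n → Fin n → Bool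
    sym   : ∀ u v → adj u v ≡ adj v u
    irrefl : ∀ v → adj v v ≡ false
open Graph public

allᵇ : ∀ {m} → (Fin m → Bool) → Bool
allᵇ {zero}  f = true
allᵇ {suc m} f = f F.zero ∧ allᵇ (λ i → f (F.suc i))

module _ {n : ℕ} (G : Graph n) where

  Stv : Fin n → Subset n
  Stv v = tabulate (adj G v)

  -- St(W) = ⋂_{w ∈ W} St(w), with St(∅) = V
  St : Subset n → Subset n
  St W = tabulate (λ x → allᵇ (λ w → not (Data.Vec.lookup W w) ∨ adj G w x))

  Sober : Set
  Sober = ∀ u v → Stv u ≡ Stv v → u ≡ v

  data Reach (u : Fin n) : Fin n → Set where
    here : Reach u u
    step : ∀ {v w} → Reach u v → adj G v w ≡ true → Reach u w

  Connected : Set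
  Connected = ∀ u v → Reach u v

  MinDegree≥2 : Set
  MinDegree≥2 = ∀ v → 2 ≤ ∣ Stv v ∣

  IsFlat : Subset n → Set
  IsFlat X = ∃ λ W → St W ≡ X

  Covers : Subset n → Subset n → Set
  Covers X Y = IsFlat X × IsFlat Y × Y ⊂ X ×
               (∀ Z → IsFlat Z → Y ⊂ Z → ¬ (Z ⊂ X))

  -- Geo G = (V, L_G), L_G = { W ∈ Fl G \ {V} | |W| ≥ 2 }

  IsLine : Subset n → Set
  IsLine W = IsFlat W × W ≢ ⊤ × 2 ≤ ∣ W ∣

  Line : Set
  Line = Refinement (Subset n) IsLine

  LeviVertex : Set
  LeviVertex = Fin n ⊎ Line

  LeviAdj : LeviVertex → LeviVertex → Set
  LeviAdj (inj₁ p) (inj₂ L) = p ∈ value L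
  LeviAdj (inj₂ L) (inj₁ p) = p ∈ value L
  LeviAdj (inj₁ _) (inj₁ _) = Empty
  LeviAdj (inj₂ _) (inj₂ _) = Empty

  IsHasseVertex : Subset n → Set
  IsHasseVertex X = IsFlat X × X ≢ ⊤ × X ≢ ⊥

  HasseVertex : Set
  HasseVertex = Refinement (Subset n) IsHasseVertex

  HasseAdj : HasseVertex → HasseVertex → Set
  HasseAdj x y = Covers (value x) (value y) ⊎ Covers (value y) (value x)

  -- c-rk via the superboolean semiring

data SB : Set where
  𝟘 𝟙 𝟙ν : SB

_⊕_ : SB → SB → SB
𝟘  ⊕ x  = x
𝟙  ⊕ 𝟘  = 𝟙
𝟙  ⊕ 𝟙  = 𝟙ν
𝟙  ⊕ 𝟙ν = 𝟙ν
𝟙ν ⊕ _  = 𝟙ν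

_⊗_ : SB → SB → SB
𝟘  ⊗ _  = 𝟘
𝟙  ⊗ 𝟘  = 𝟘
𝟙  ⊗ x  = x
𝟙ν ⊗ 𝟘  = 𝟘
𝟙ν ⊗ _  = 𝟙ν

sumSB : ∀ {m} → (Fin m → SB) → SB
sumSB {zero}  f = 𝟘
sumSB {suc m} f = f F.zero ⊕ sumSB (λ i → f (F.suc i))

fromBool : Bool → SB
fromBool true  = 𝟙
fromBool false = 𝟘

module _ {n : ℕ} (G : Graph n) where

  Ac : Fin n → Fin n → SB
  Ac i j = if adj G i j then 𝟘 else 𝟙

  DependentCols : Subset n → Set
  DependentCols S = ∃ λ (c : Subset n) → c ⊆ S × Nonempty c ×
    (∀ i → sumSB (λ j → fromBool (Data.Vec.lookup c j) ⊗ Ac i j) ≢ 𝟙)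

  IndependentCols : Subset n → Set
  IndependentCols S = ¬ DependentCols S

  CRank≡ : ℕ → Set
  CRank≡ k = (∃ λ S → IndependentCols S × ∣ S ∣ ≡ k) ×
             (∀ S → IndependentCols S → ∣ S ∣ ≤ k)

record GraphIso {A B : Set} (R : A → A → Set) (S : B → B → Set) : Set where
  field
    bij      : A ⤖ B
    preserve : ∀ x y → R x y ⇔ S (Bijection.to bij x) (Bijection.to bij y)

module Submission where

-- The rank hypothesis is used only through one combinatorial consequence:
-- a "staircase" of columns s₁ … s_k with rows w₁ … w_k such that w_i misses
-- s_i but is adjacent to every later s_j gives k independent columns of A^c
-- (the row w_i of the first chosen column sums to exactly 1), so c-rk 3
-- forbids staircases of length 4.  Exhibiting such staircases shows
--   (a) St(St(p)) = {p} for every vertex p, so every singleton is a flat,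
--       using soberness and minimum degree 2;
--   (b) no flat lies strictly between a proper flat L and a flat with at
--       least two points.
-- Hence the proper nonempty flats are exactly the points {p} and the lines,
-- the covering relation holds exactly between {p} and the lines through p,
-- and p ↦ {p}, L ↦ L is the required isomorphism.

open import Defs hiding (sym)
open import Data.Nat using (ℕ; zero; suc; _≤_; s≤s; z≤n; _≤?_)
open import Data.Nat.Properties using (≤-trans; ≤-reflexive; <-irrefl; <-≤-trans; ≤-<-trans; <⇒≤)
open import Data.Bool using (Bool; true; false; not; _∨_)
import Data.Bool.Properties as Bool
open import Data.Fin using (Fin)
import Data.Fin as F
open import Data.Fin.Properties using (any?; suc-injective) renaming (_≟_ to _≟ᶠ_)
open import Data.List using (List; []; _∷_; length)
open import Data.List.Relation.Unary.All using (All; []; _∷_)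
open import Data.Vec using (tabulate; lookup)
open import Data.Vec.Properties using (lookup∘tabulate; []=⇒lookup; lookup⇒[]=; ≡-dec)
open import Data.Fin.Subset using (Subset; _∈_; _∉_; _⊆_; _⊂_; ⊤; ⊥; ∣_∣; Nonempty; ⁅_⁆; _∪_)
open import Data.Fin.Subset.Properties
  using (_∈?_; x∈⁅x⁆; x∈⁅y⁆⇒x≡y; ∣⁅x⁆∣≡1; x≢y⇒x∉⁅y⁆; x∉⁅y⁆⇒x≢y; ⊆-antisym; x∈p∪q⁻; x∈p∪q⁺; q⊆p∪q;
         p⊂q⇒∣p∣<∣q∣; p⊆q⇒∣p∣≤∣q∣; nonempty?; Empty-unique; ∣⊥∣≡0; ∈⊤; ∉⊥)
open import Data.Sum using (inj₁; inj₂)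
open import Data.Product using (_×_; ∃; ∃₂; _,_; proj₁; proj₂)
open import Data.Empty renaming (⊥ to Empty) using (⊥-elim; ⊥-elim-irr)
open import Relation.Nullary using (¬_; Dec; yes; no)
open import Relation.Nullary.Decidable using (_×-dec_; ¬?; recompute)
open import Relation.Binary.PropositionalEquality using (_≡_; _≢_; refl; sym; trans; cong; subst; ≢-sym)
open import Function.Bundles using (_⤖_; _⇔_; mk⇔; Bijection; mk↔ₛ′)
open import Function.Properties.Inverse using (↔⇒⤖)
open import Data.Refinement using (value-injective; _,_)
open import Data.Irrelevant using ([_])

module _ {m : ℕ} where

  ∈-tabulate⁺ : (f : Fin m → Bool) {x : Fin m} → f x ≡ true → x ∈ tabulate f
  ∈-tabulate⁺ f {x} fx = lookup⇒[]= x _ (trans (lookup∘tabulate f x) fx)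

  ∈-tabulate⁻ : (f : Fin m → Bool) {x : Fin m} → x ∈ tabulate f → f x ≡ true
  ∈-tabulate⁻ f {x} x∈ = trans (sym (lookup∘tabulate f x)) ([]=⇒lookup x∈)

  ∉-tabulate : (f : Fin m → Bool) {x : Fin m} → x ∉ tabulate f → f x ≡ false
  ∉-tabulate f {x} x∉ with f x in fx
  ... | true  = ⊥-elim (x∉ (∈-tabulate⁺ f fx))
  ... | false = refl

  ⁅⁆⊆ : {X : Subset m} {x : Fin m} → x ∈ X → ⁅ x ⁆ ⊆ X
  ⁅⁆⊆ {X} {x} x∈X y∈⁅x⁆ = subst (_∈ X) (sym (x∈⁅y⁆⇒x≡y x y∈⁅x⁆)) x∈X

  ⊆-⁅⁆ : {X : Subset m} {x : Fin m} → (∀ {y} → y ∈ X → y ≢ x → Empty) → X ⊆ ⁅ x ⁆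
  ⊆-⁅⁆ {x = x} only-x {y} y∈X with y ≟ᶠ x
  ... | yes refl = x∈⁅x⁆ x
  ... | no  y≢x  = ⊥-elim (only-x y∈X y≢x)

  1≤∣⁅x⁆∣ : (x : Fin m) → 1 ≤ ∣ ⁅ x ⁆ ∣
  1≤∣⁅x⁆∣ x = ≤-reflexive (sym (∣⁅x⁆∣≡1 x))

  ¬2≤∣⁅x⁆∣ : (x : Fin m) → ¬ (2 ≤ ∣ ⁅ x ⁆ ∣)
  ¬2≤∣⁅x⁆∣ x two with ≤-trans two (≤-reflexive (∣⁅x⁆∣≡1 x))
  ... | s≤s ()

  -- A subset different from ⊥ has an element; the hypothesis is only used
  -- to rule out the empty case, so it may be irrelevant.
  element : (X : Subset m) → .(X ≢ ⊥) → Nonempty X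
  element X X≢⊥ with nonempty? X
  ... | yes ne = ne
  ... | no ¬ne = ⊥-elim-irr (X≢⊥ (Empty-unique ¬ne))

  ≢⊥-of-card : (X : Subset m) → 1 ≤ ∣ X ∣ → X ≢ ⊥
  ≢⊥-of-card X one refl with ≤-trans one (≤-reflexive (∣⊥∣≡0 m))
  ... | ()

  two-elements : (X : Subset m) → 2 ≤ ∣ X ∣ → ∃₂ λ x y → x ∈ X × y ∈ X × x ≢ y
  two-elements X two with element X (≢⊥-of-card X (<⇒≤ two))
  ... | x , x∈X with any? (λ y → (y ∈? X) ×-dec ¬? (y ≟ᶠ x))
  ... | yes (y , y∈X , y≢x) = x , y , x∈X , y∈X , ≢-sym y≢x
  ... | no ¬other = ⊥-elim (¬2≤∣⁅x⁆∣ x (≤-trans two (p⊆q⇒∣p∣≤∣q∣ X⊆⁅x⁆)))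
    where
    X⊆⁅x⁆ : X ⊆ ⁅ x ⁆
    X⊆⁅x⁆ = ⊆-⁅⁆ (λ {y} y∈X y≢x → ¬other (y , y∈X , y≢x))

  other-element : (X : Subset m) (p : Fin m) → 2 ≤ ∣ X ∣ → ∃ λ s → s ∈ X × s ≢ p
  other-element X p two with two-elements X two
  ... | a , b , a∈X , b∈X , a≢b with a ≟ᶠ p
  ... | yes refl = b , b∈X , ≢-sym a≢b
  ... | no  a≢p  = a , a∈X , a≢p

  card-of-two : {X : Subset m} {x y : Fin m} → x ∈ X → y ∈ X → x ≢ y → 2 ≤ ∣ X ∣
  card-of-two {X} {x} {y} x∈X y∈X x≢y =
    ≤-<-trans (1≤∣⁅x⁆∣ x) (p⊂q⇒∣p∣<∣q∣ ⁅x⁆⊂X)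
    where
    ⁅x⁆⊂X : ⁅ x ⁆ ⊂ X
    ⁅x⁆⊂X = ⁅⁆⊆ x∈X , y , y∈X , x≢y⇒x∉⁅y⁆ (≢-sym x≢y)

  singleton-of-small : {X : Subset m} {x : Fin m} → x ∈ X → ¬ (2 ≤ ∣ X ∣) → ⁅ x ⁆ ≡ X
  singleton-of-small x∈X small =
    ⊆-antisym (⁅⁆⊆ x∈X) (⊆-⁅⁆ (λ y∈X y≢x → small (card-of-two y∈X x∈X y≢x)))

  missing-element : (X : Subset m) → X ≢ ⊤ → ∃ λ x → x ∉ X
  missing-element X X≢⊤ with any? (λ y → ¬? (y ∈? X))
  ... | yes missing = missing
  ... | no ¬missing = ⊥-elim (X≢⊤ (⊆-antisym (λ _ → ∈⊤) ⊤⊆X))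
    where
    ⊤⊆X : ⊤ ⊆ X
    ⊤⊆X {y} _ with y ∈? X
    ... | yes y∈X = y∈X
    ... | no  y∉X = ⊥-elim (¬missing (y , y∉X))

allᵇ-true : ∀ {m} (f : Fin m → Bool) → (∀ i → f i ≡ true) → allᵇ f ≡ true
allᵇ-true {zero}  f all-true = refl
allᵇ-true {suc m} f all-true rewrite all-true F.zero =
  allᵇ-true (λ j → f (F.suc j)) (λ i → all-true (F.suc i))

allᵇ-true⁻ : ∀ {m} (f : Fin m → Bool) → allᵇ f ≡ true → ∀ i → f i ≡ true
allᵇ-true⁻ {suc m} f all-true i with f F.zero in f0
allᵇ-true⁻ {suc m} f all-true F.zero    | true = f0
allᵇ-true⁻ {suc m} f all-true (F.suc i) | true = allᵇ-true⁻ (λ j → f (F.suc j)) all-true i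

allᵇ-false : ∀ {m} (f : Fin m → Bool) → allᵇ f ≡ false → ∃ λ i → f i ≡ false
allᵇ-false {suc m} f not-all with f F.zero in f0
... | false = F.zero , f0
... | true with allᵇ-false (λ j → f (F.suc j)) not-all
...   | i , fi = F.suc i , fi

module Neighbourhoods {n : ℕ} (G : Graph n) where

  N : Fin n → Subset n
  N = Stv G

  adj-sym : ∀ {u v} → adj G u v ≡ true → adj G v u ≡ true
  adj-sym {u} {v} uv = trans (sym (Graph.sym G u v)) uv

  adj⇒≢ : ∀ {u v} → adj G u v ≡ true → u ≢ v
  adj⇒≢ {u} uu refl with trans (sym uu) (irrefl G u)
  ... | ()

  neighbour⁺ : ∀ {v x} → adj G v x ≡ true → x ∈ N v
  neighbour⁺ = ∈-tabulate⁺ _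

  neighbour⁻ : ∀ {v x} → x ∈ N v → adj G v x ≡ true
  neighbour⁻ = ∈-tabulate⁻ _

  non-neighbour : ∀ {v x} → x ∉ N v → adj G v x ≡ false
  non-neighbour = ∉-tabulate _

  ∈-St⁺ : ∀ {W x} → (∀ w → w ∈ W → adj G w x ≡ true) → x ∈ St G W
  ∈-St⁺ {W} {x} adj-all = ∈-tabulate⁺ _ (allᵇ-true _ λ w → entry w (lookup W w) refl)
    where
    entry : ∀ w b → lookup W w ≡ b → not b ∨ adj G w x ≡ true
    entry w true  Ww = adj-all w (lookup⇒[]= w W Ww)
    entry w false Ww = refl

  ∈-St⁻ : ∀ {W x w} → x ∈ St G W → w ∈ W → adj G w x ≡ true
  ∈-St⁻ {W} {x} {w} x∈St w∈W =
    subst (λ b → not b ∨ adj G w x ≡ true) ([]=⇒lookup w∈W)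
          (allᵇ-true⁻ _ (∈-tabulate⁻ _ x∈St) w)

  ∉-St : ∀ {W x} → x ∉ St G W → ∃ λ w → w ∈ W × adj G w x ≡ false
  ∉-St {W} {x} x∉St with allᵇ-false _ (∉-tabulate _ x∉St)
  ... | w , entry = w , witness (lookup W w) refl entry
    where
    witness : ∀ b → lookup W w ≡ b → not b ∨ adj G w x ≡ false → w ∈ W × adj G w x ≡ false
    witness true Ww wx = lookup⇒[]= w W Ww , wx

  -- St is antitone and St ∘ St is extensive, so flats are closed.
  St-antitone : {A B : Subset n} → A ⊆ B → St G B ⊆ St G A
  St-antitone A⊆B x∈StB = ∈-St⁺ (λ w w∈A → ∈-St⁻ x∈StB (A⊆B w∈A))

  ⊆-St-St : (X : Subset n) → X ⊆ St G (St G X)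
  ⊆-St-St X x∈X = ∈-St⁺ (λ w w∈StX → adj-sym (∈-St⁻ w∈StX x∈X))

  flat-closed : {L : Subset n} → IsFlat G L → St G (St G L) ≡ L
  flat-closed (W , refl) = ⊆-antisym (St-antitone (⊆-St-St W)) (⊆-St-St (St G W))

  -- Being a flat is decidable, so a flat proof can be recovered from an
  -- irrelevant one.
  recompute-flat : (L : Subset n) → .(IsFlat G L) → IsFlat G L
  recompute-flat L flat = St G L , recompute (≡-dec Bool._≟_ (St G (St G L)) L) (flat-closed flat)

  self-∈-St-N : ∀ v → v ∈ St G (N v)
  self-∈-St-N v = ∈-St⁺ (λ w w∈Nv → adj-sym (neighbour⁻ w∈Nv))

  St-N⇒⊆ : ∀ {u v} → u ∈ St G (N v) → N v ⊆ N u
  St-N⇒⊆ u∈St x∈Nv = neighbour⁺ (adj-sym (∈-St⁻ u∈St x∈Nv))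

sum-zeros : ∀ {m} (f : Fin m → SB) → (∀ j → f j ≡ 𝟘) → sumSB f ≡ 𝟘
sum-zeros {zero}  f zeros = refl
sum-zeros {suc m} f zeros rewrite zeros F.zero = sum-zeros _ (λ j → zeros (F.suc j))

sum-single-one : ∀ {m} (f : Fin m → SB) j₀ → f j₀ ≡ 𝟙 → (∀ j → j ≢ j₀ → f j ≡ 𝟘) → sumSB f ≡ 𝟙
sum-single-one f F.zero one zeros
  rewrite one | sum-zeros (λ j → f (F.suc j)) (λ j → zeros (F.suc j) λ ()) = refl
sum-single-one f (F.suc k) one zeros rewrite zeros F.zero (λ ()) =
  sum-single-one (λ j → f (F.suc j)) k one (λ j j≢k → zeros (F.suc j) (λ eq → j≢k (suc-injective eq)))

-- Staircases: a lower bound for c-rk.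

module Staircases {n : ℕ} (G : Graph n) where

  data Staircase : List (Fin n × Fin n) → Set where
    []    : Staircase []
    stair : ∀ {s w ps} → adj G w s ≡ false → All (λ p → adj G w (proj₁ p) ≡ true) ps →
            Staircase ps → Staircase ((s , w) ∷ ps)

  columns : List (Fin n × Fin n) → Subset n
  columns []            = ⊥
  columns ((s , _) ∷ ps) = ⁅ s ⁆ ∪ columns ps

  adjacent-to-columns : ∀ {w ps j} → All (λ p → adj G w (proj₁ p) ≡ true) ps →
                        j ∈ columns ps → adj G w j ≡ true
  adjacent-to-columns {ps = []} [] j∈ = ⊥-elim (∉⊥ j∈)
  adjacent-to-columns {ps = (s , _) ∷ ps} {j} (ws ∷ rest) j∈ with x∈p∪q⁻ ⁅ s ⁆ (columns ps) j∈
  ... | inj₁ j∈⁅s⁆ = subst (λ t → adj G _ t ≡ true) (sym (x∈⁅y⁆⇒x≡y s j∈⁅s⁆)) ws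
  ... | inj₂ j∈ps  = adjacent-to-columns rest j∈ps

  columns-tail : ∀ {s w ps j} → j ∈ columns ((s , w) ∷ ps) → j ≢ s → j ∈ columns ps
  columns-tail {s} {ps = ps} j∈ j≢s with x∈p∪q⁻ ⁅ s ⁆ (columns ps) j∈
  ... | inj₁ j∈⁅s⁆ = ⊥-elim (j≢s (x∈⁅y⁆⇒x≡y s j∈⁅s⁆))
  ... | inj₂ j∈ps  = j∈ps

  row-single-miss : (c : Subset n) (i j₀ : Fin n) → j₀ ∈ c → adj G i j₀ ≡ false →
                    (∀ j → j ∈ c → j ≢ j₀ → adj G i j ≡ true) →
                    sumSB (λ j → fromBool (lookup c j) ⊗ Ac G i j) ≡ 𝟙
  row-single-miss c i j₀ j₀∈c miss hits = sum-single-one _ j₀ at-j₀ elsewhere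
    where
    at-j₀ : fromBool (lookup c j₀) ⊗ Ac G i j₀ ≡ 𝟙
    at-j₀ rewrite []=⇒lookup j₀∈c | miss = refl
    elsewhere : ∀ j → j ≢ j₀ → fromBool (lookup c j) ⊗ Ac G i j ≡ 𝟘
    elsewhere j j≢j₀ with lookup c j in cj
    ... | false = refl
    ... | true rewrite hits j (lookup⇒[]= j c cj) j≢j₀ = refl

  -- The columns of a staircase are independent: the row of the first chosen
  -- column certifies a coordinate equal to 𝟙.
  staircase-independent : ∀ {ps} → Staircase ps → IndependentCols G (columns ps)
  staircase-independent [] (c , c⊆⊥ , (x , x∈c) , _) = ∉⊥ (c⊆⊥ x∈c)
  staircase-independent (stair {s} {w} {ps} miss hits rest) (c , c⊆ , nonempty , no-one) with s ∈? c
  ... | yes s∈c = no-one w (row-single-miss c w s s∈c miss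
      (λ j j∈c j≢s → adjacent-to-columns hits (columns-tail {s} {w} {ps} (c⊆ j∈c) j≢s)))
  ... | no  s∉c = staircase-independent rest (c , c⊆tail , nonempty , no-one)
    where
    c⊆tail : c ⊆ columns ps
    c⊆tail j∈c = columns-tail {s} {w} {ps} (c⊆ j∈c) (λ { refl → s∉c j∈c })

  -- The columns of a staircase are pairwise distinct.
  staircase-size : ∀ {ps} → Staircase ps → length ps ≤ ∣ columns ps ∣
  staircase-size []                                  = z≤n
  staircase-size (stair {s} {ps = ps} miss hits rest) =
    <-≤-trans (s≤s (staircase-size rest)) (p⊂q⇒∣p∣<∣q∣ tail⊂)
    where
    s∉tail : s ∉ columns ps
    s∉tail s∈ with trans (sym miss) (adjacent-to-columns hits s∈)
    ... | ()
    tail⊂ : columns ps ⊂ ⁅ s ⁆ ∪ columns ps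
    tail⊂ = q⊆p∪q ⁅ s ⁆ (columns ps) , s , x∈p∪q⁺ (inj₁ (x∈⁅x⁆ s)) , s∉tail

  staircase-bound : ∀ {k ps} → CRank≡ G k → Staircase ps → length ps ≤ k
  staircase-bound (_ , maximal) st = ≤-trans (staircase-size st) (maximal _ (staircase-independent st))

module RankThree {n : ℕ} (G : Graph n) (sober : Sober G) (cr : CRank≡ G 3) (deg : MinDegree≥2 G) where
  open Neighbourhoods G
  open Staircases G

  no-staircase-of-length-4 : ∀ {ps} → Staircase ps → length ps ≡ 4 → Empty
  no-staircase-of-length-4 st four = <-irrefl refl (subst (_≤ 3) four (staircase-bound cr st))

  private-neighbour : ∀ {p q} → N p ⊆ N q → q ≢ p → ∃ λ r → r ∈ N q × r ∉ N p
  private-neighbour {p} {q} Np⊆Nq q≢p with any? (λ r → (r ∈? N q) ×-dec ¬? (r ∈? N p))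
  ... | yes r = r
  ... | no ¬r = ⊥-elim (q≢p (sober q p (⊆-antisym Nq⊆Np Np⊆Nq)))
    where
    Nq⊆Np : N q ⊆ N p
    Nq⊆Np {y} y∈Nq with y ∈? N p
    ... | yes y∈Np = y∈Np
    ... | no  y∉Np = ⊥-elim (¬r (y , y∈Nq , y∉Np))

  -- Two distinct neighbours x, y of p, one of which is outside the closure
  -- of the other's neighbourhood (otherwise N(x) = N(y), so x = y).
  separated-neighbours : ∀ p → ∃₂ λ x y → x ∈ N p × y ∈ N p × x ∉ St G (N y)
  separated-neighbours p with two-elements (N p) (deg p)
  ... | a , b , a∈ , b∈ , a≢b with b ∈? St G (N a)
  ... | no  b∉ = b , a , b∈ , a∈ , b∉
  ... | yes b∈St = a , b , a∈ , b∈ , λ a∈St →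
          a≢b (sober a b (⊆-antisym (St-N⇒⊆ b∈St) (St-N⇒⊆ a∈St)))

  -- (a) The closure of N(p) is {p}: otherwise q, r, x, y with rows
  -- q, p, w, y form a staircase of length 4.
  closure-of-point : ∀ p q → q ∈ St G (N p) → q ≡ p
  closure-of-point p q q∈St with q ≟ᶠ p
  ... | yes q≡p = q≡p
  ... | no  q≢p with private-neighbour (St-N⇒⊆ q∈St) q≢p | separated-neighbours p
  ... | r , r∈Nq , r∉Np | x , y , x∈Np , y∈Np , x∉St with ∉-St x∉St
  ... | w , w∈Ny , wx = ⊥-elim (no-staircase-of-length-4
        (stair (irrefl G q) (neighbour⁻ r∈Nq ∷ qx ∷ qy ∷ [])
        (stair (non-neighbour r∉Np) (neighbour⁻ x∈Np ∷ neighbour⁻ y∈Np ∷ [])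
        (stair wx (adj-sym (neighbour⁻ w∈Ny) ∷ [])
        (stair (irrefl G y) [] []))))
        refl)
    where
    qx : adj G q x ≡ true
    qx = neighbour⁻ (St-N⇒⊆ q∈St x∈Np)
    qy : adj G q y ≡ true
    qy = neighbour⁻ (St-N⇒⊆ q∈St y∈Np)

  separated-from-point : ∀ {p s} → s ≢ p → ∃ λ w → w ∈ N p × adj G w s ≡ false
  separated-from-point {p} {s} s≢p = ∉-St (λ s∈St → s≢p (closure-of-point p s s∈St))

  singleton-flat : ∀ p → IsFlat G ⁅ p ⁆
  singleton-flat p = N p , ⊆-antisym (⊆-⁅⁆ (λ q∈ q≢p → q≢p (closure-of-point p _ q∈)))
                                      (⁅⁆⊆ (self-∈-St-N p))

  singleton-proper : ∀ p → ⁅ p ⁆ ≢ ⊤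
  singleton-proper p ⁅p⁆≡⊤ with two-elements (N p) (deg p)
  ... | a , _ , a∈Np , _ =
    adj⇒≢ (neighbour⁻ a∈Np) (sym (x∈⁅y⁆⇒x≡y p (subst (a ∈_) (sym ⁅p⁆≡⊤) ∈⊤)))

  -- (b) A flat Z with two points p ≠ s is not strictly below a proper flat
  -- L: columns s₁ ∉ L, s₂ ∈ L ∖ Z, s, p with rows certifying s₁ ∉ L,
  -- s₂ ∉ Z, s ∉ St(N p) = {p}, and p itself form a staircase of length 4.
  no-flat-between : ∀ {L Z : Subset n} {p s : Fin n} → IsFlat G L → L ≢ ⊤ → IsFlat G Z →
                    Z ⊂ L → p ∈ Z → s ∈ Z → s ≢ p → Empty
  no-flat-between {p = p} {s} (WL , refl) L≢⊤ (WZ , refl) (Z⊆L , s₂ , s₂∈L , s₂∉Z) p∈Z s∈Z s≢p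
    with missing-element _ L≢⊤
  ... | s₁ , s₁∉L with ∉-St {W = WL} s₁∉L | ∉-St {W = WZ} s₂∉Z | separated-from-point s≢p
  ... | w₁ , w₁∈WL , w₁s₁ | w₂ , w₂∈WZ , w₂s₂ | w₃ , w₃∈Np , w₃s = no-staircase-of-length-4
        (stair w₁s₁ (∈-St⁻ s₂∈L w₁∈WL ∷ ∈-St⁻ (Z⊆L s∈Z) w₁∈WL ∷ ∈-St⁻ (Z⊆L p∈Z) w₁∈WL ∷ [])
        (stair w₂s₂ (∈-St⁻ s∈Z w₂∈WZ ∷ ∈-St⁻ p∈Z w₂∈WZ ∷ [])
        (stair w₃s (adj-sym (neighbour⁻ w₃∈Np) ∷ [])
        (stair (irrefl G p) [] []))))
        refl

module Isomorphism {n : ℕ} (G : Graph n) (sober : Sober G) (cr : CRank≡ G 3) (deg : MinDegree≥2 G) where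
  open Neighbourhoods G
  open RankThree G sober cr deg

  line-size : (L : Subset n) → .(IsLine G L) → 2 ≤ ∣ L ∣
  line-size L line = recompute (2 ≤? ∣ L ∣) (proj₂ (proj₂ line))

  toHasse : LeviVertex G → HasseVertex G
  toHasse (inj₁ p) = ⁅ p ⁆ , [ (singleton-flat p , singleton-proper p , ≢⊥-of-card ⁅ p ⁆ (1≤∣⁅x⁆∣ p)) ]
  toHasse (inj₂ (L , [ line ])) =
    L , [ (proj₁ line , proj₁ (proj₂ line) , ≢⊥-of-card L (<⇒≤ (proj₂ (proj₂ line)))) ]

  fromHasse′ : (X : Subset n) → .(IsHasseVertex G X) → Dec (2 ≤ ∣ X ∣) → LeviVertex G
  fromHasse′ X hv (yes two) = inj₂ (X , [ (proj₁ hv , proj₁ (proj₂ hv) , two) ])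
  fromHasse′ X hv (no  _)   = inj₁ (proj₁ (element X (proj₂ (proj₂ hv))))

  fromHasse : HasseVertex G → LeviVertex G
  fromHasse (X , [ hv ]) = fromHasse′ X hv (2 ≤? ∣ X ∣)

  to∘from : ∀ X → toHasse (fromHasse X) ≡ X
  to∘from (X , [ hv ]) = by-size (2 ≤? ∣ X ∣)
    where
    by-size : (d : Dec (2 ≤ ∣ X ∣)) → toHasse (fromHasse′ X hv d) ≡ (X , [ hv ])
    by-size (yes _)    = refl
    by-size (no small) = value-injective (singleton-of-small (proj₂ (element X _)) small)

  from∘to : ∀ x → fromHasse (toHasse x) ≡ x
  from∘to (inj₁ p) = point _ (2 ≤? ∣ ⁅ p ⁆ ∣)
    where
    point : .(hv : IsHasseVertex G ⁅ p ⁆) (d : Dec (2 ≤ ∣ ⁅ p ⁆ ∣)) → fromHasse′ ⁅ p ⁆ hv d ≡ inj₁ p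
    point _ (yes two) = ⊥-elim (¬2≤∣⁅x⁆∣ p two)
    point _ (no  _)   = cong inj₁ (x∈⁅y⁆⇒x≡y p (proj₂ (element ⁅ p ⁆ _)))
  from∘to (inj₂ (L , [ line ])) = line-case _ (2 ≤? ∣ L ∣)
    where
    line-case : .(hv : IsHasseVertex G L) (d : Dec (2 ≤ ∣ L ∣)) → fromHasse′ L hv d ≡ inj₂ (L , [ line ])
    line-case _ (yes _)     = refl
    line-case _ (no  small) = ⊥-elim-irr (small (proj₂ (proj₂ line)))

  vertices : LeviVertex G ⤖ HasseVertex G
  vertices = ↔⇒⤖ (mk↔ₛ′ toHasse fromHasse to∘from from∘to)

  ¬singleton-covers : ∀ {X : Subset n} {p} → 1 ≤ ∣ X ∣ → ¬ Covers G ⁅ p ⁆ X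
  ¬singleton-covers {p = p} one (_ , _ , X⊂⁅p⁆ , _) =
    <-irrefl refl (<-≤-trans (≤-<-trans one (p⊂q⇒∣p∣<∣q∣ X⊂⁅p⁆)) (≤-reflexive (∣⁅x⁆∣≡1 p)))

  covers-point⇒∈ : ∀ {X : Subset n} {p} → Covers G X ⁅ p ⁆ → p ∈ X
  covers-point⇒∈ {p = p} (_ , _ , (⁅p⁆⊆X , _) , _) = ⁅p⁆⊆X (x∈⁅x⁆ p)

  -- A line covers each of its points: a flat strictly between would contain
  -- two points, contradicting no-flat-between.
  line-covers-point : ∀ (L : Subset n) p → .(IsLine G L) → p ∈ L → Covers G L ⁅ p ⁆
  line-covers-point L p line p∈L with other-element L p (line-size L line)
  ... | s , s∈L , s≢p =
    flat-L , singleton-flat p , (⁅⁆⊆ p∈L , s , s∈L , x≢y⇒x∉⁅y⁆ s≢p) ,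
    λ { Z flat-Z (⁅p⁆⊆Z , t , t∈Z , t∉⁅p⁆) Z⊂L →
          no-flat-between flat-L (λ L≡⊤ → ⊥-elim-irr (proj₁ (proj₂ line) L≡⊤)) flat-Z Z⊂L
            (⁅p⁆⊆Z (x∈⁅x⁆ p)) t∈Z (x∉⁅y⁆⇒x≢y t∉⁅p⁆) }
    where
    flat-L : IsFlat G L
    flat-L = recompute-flat L (proj₁ line)

  ¬covers-line : ∀ {X Y : Subset n} → .(X ≢ ⊤) → 2 ≤ ∣ Y ∣ → ¬ Covers G X Y
  ¬covers-line X≢⊤ two (flat-X , flat-Y , Y⊂X , _) with two-elements _ two
  ... | a , b , a∈Y , b∈Y , a≢b =
    no-flat-between flat-X (λ X≡⊤ → ⊥-elim-irr (X≢⊤ X≡⊤)) flat-Y Y⊂X a∈Y b∈Y (≢-sym a≢b)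

  preserve : ∀ x y → LeviAdj G x y ⇔ HasseAdj G (Bijection.to vertices x) (Bijection.to vertices y)
  preserve (inj₁ p) (inj₁ q) = mk⇔ (λ ())
    λ { (inj₁ q-covered) → ¬singleton-covers (1≤∣⁅x⁆∣ q) q-covered
      ; (inj₂ p-covered) → ¬singleton-covers (1≤∣⁅x⁆∣ p) p-covered }
  preserve (inj₁ p) (inj₂ (L , [ line ])) = mk⇔ (λ p∈L → inj₂ (line-covers-point L p line p∈L))
    λ { (inj₁ L-covered) → ⊥-elim (¬singleton-covers (<⇒≤ (line-size L line)) L-covered)
      ; (inj₂ p-covered) → covers-point⇒∈ p-covered }
  preserve (inj₂ (L , [ line ])) (inj₁ p) = mk⇔ (λ p∈L → inj₁ (line-covers-point L p line p∈L))
    λ { (inj₁ p-covered) → covers-point⇒∈ p-covered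
      ; (inj₂ L-covered) → ⊥-elim (¬singleton-covers (<⇒≤ (line-size L line)) L-covered) }
  preserve (inj₂ (L , [ line ])) (inj₂ (M , [ line′ ])) = mk⇔ (λ ())
    λ { (inj₁ M-covered) → ¬covers-line (proj₁ (proj₂ line)) (line-size M line′) M-covered
      ; (inj₂ L-covered) → ¬covers-line (proj₁ (proj₂ line′)) (line-size L line) L-covered }

  levi≅hasse : GraphIso (LeviAdj G) (HasseAdj G)
  levi≅hasse = record { bij = vertices ; preserve = preserve }

proposition6p12 : ∀ {n : ℕ} (G : Graph n) → Sober G → Connected G →
    CRank≡ G 3 → MinDegree≥2 G →
    GraphIso (LeviAdj G) (HasseAdj G)
proposition6p12 G sober _ cr deg = Isomorphism.levi≅hasse G sober cr deg
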